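{- Let $q\ge 2$ be an integer and let $I\subset\{0,\dots,q-1\}$ with $1\le |I|<q$. Then the graph $R^q_I$ is isomorphic to the Rado graph.
   Context: $R^q_I$ is the graph with vertex set $\mathbb{N}=\{0,1,2,\dots\}$ in which $\{x,y\}$ with $x<y$ is an edge iff the $x$-th digit (counting from the least significant digit, digit $0$) of the base-$q$ expansion of $y$ belongs to $I$. The Rado graph $R$ is $R^2_{\{1\}}$, i.e. $\{i,j\}$ with $i<j$ is an edge iff the $i$-th binary digit of $j$ is $1$. -}

module Defs where

open import Data.Nat using (ℕ; _<_; _^_; _≥_; NonZero)
open import Data.Nat.DivMod using (_/_; _%_; m%n<n)
open import Data.Nat.Properties using (m^n≢0)
open import Data.Fin using (Fin; fromℕ<)
open import Data.Fin.Subset using (Subset; _∈_)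
open import Data.Sum using (_⊎_)
open import Data.Product using (_×_; Σ)
open import Function.Bundles using (Bijection; _⤖_; _⇔_)
open import Relation.Binary.PropositionalEquality using (_≡_)

digit : (q : ℕ) .{{_ : NonZero q}} → ℕ → ℕ → Fin q
digit q x y = fromℕ< (m%n<n (y / (q ^ x) ) q)
  where instance _ = m^n≢0 q x

Adj : (q : ℕ) .{{_ : NonZero q}} → Subset q → ℕ → ℕ → Set
Adj q I x y = (x < y × digit q x y ∈ I) ⊎ (y < x × digit q y x ∈ I)

RadoAdj : ℕ → ℕ → Set
RadoAdj x y = (x < y × digit 2 x y ≡ Fin.suc Fin.zero) ⊎ (y < x × digit 2 y x ≡ Fin.suc Fin.zero)
  where import Data.Fin as Fin

GraphIso : (ℕ → ℕ → Set) → (ℕ → ℕ → Set) → Set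
GraphIso E F = Σ (ℕ ⤖ ℕ) λ f →
  ∀ x y → E x y ⇔ F (Bijection.to f x) (Bijection.to f y)

-- Call a graph on ℕ an extension graph if for every finite set L and every prescription P
-- on L some vertex outside L is adjacent to exactly the w ∈ L with P w.  Any two extension
-- graphs are isomorphic by back and forth: a finite partial isomorphism extends to any given
-- vertex on either side, and the union of a chain of such extensions is a bijection.
-- R^q_I is an extension graph as soon as I contains some digit d₁ and misses some digit d₀:
-- the vertex whose w-th digit is d₁ or d₀ according to P w, for w ∈ L, and which exceeds
-- max L, does the job.  The Rado graph is R^2_{1}.

module Submission where

open import Defs
open import Data.Nat using (ℕ; zero; suc; _+_; _*_; _^_; _⊔_; _≤_; _<_; _≥_; _≤′_; ≤′-reflexive; ≤′-step;
                            s≤s; z≤n; _≟_; _<?_; NonZero)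
open import Data.Nat.Properties
open import Data.Nat.DivMod using (_/_; _%_; [m+kn]%n≡m%n; m<n⇒m%n≡m; +-distrib-/-∣ʳ; m<n⇒m/n≡0; m*n/n≡m;
                                   m/n/o≡m/[n*o]; n/1≡n)
open import Data.Nat.Divisibility using (divides-refl)
open import Data.Fin using (Fin; zero; suc; toℕ)
open import Data.Fin.Properties using (toℕ<n; toℕ-fromℕ<; toℕ-injective) renaming (_≟_ to _≟ᶠ_)
open import Data.Fin.Subset using (Subset; ∣_∣; inside; outside) renaming (_∈_ to _∈ₛ_; _∉_ to _∉ₛ_)
open import Data.Fin.Subset.Properties using (_∈?_)
open import Data.Vec using (_∷_; here; there)
open import Data.List using (List; []; _∷_; map)
open import Data.List.Extrema.Nat using (max; xs≤max)
import Data.List.Relation.Unary.All as All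
open import Data.List.Relation.Unary.Any using (Any; here; there; any?)
open import Data.List.Membership.Propositional using (_∈_; _∉_; find; lose)
open import Data.List.Membership.Propositional.Properties using (∈-map⁺; ∈-map⁻)
open import Data.List.Relation.Binary.Subset.Propositional using (_⊆_)
open import Data.Product using (_×_; _,_; proj₁; proj₂; swap; ∃-syntax)
open import Data.Sum using (_⊎_; inj₁; inj₂; [_,_])
open import Data.Empty using (⊥-elim)
open import Function using (_∘_; id)
open import Function.Bundles using (_⇔_; mk⇔; Equivalence; mk⤖)
open import Function.Construct.Symmetry using (⇔-sym)
open import Relation.Nullary using (¬_; Dec; yes; no)
open import Relation.Nullary.Decidable using (_×-dec_; _⊎-dec_)
open import Relation.Binary.PropositionalEquality using (_≡_; refl; sym; trans; cong; cong₂; subst; module ≡-Reasoning)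

module Digits (q : ℕ) .{{_ : NonZero q}} where

  withDigits : ℕ → (ℕ → ℕ) → ℕ
  withDigits zero    g = 1
  withDigits (suc n) g = g 0 + withDigits n (g ∘ suc) * q

  [a+r*q]%q≡a : ∀ {a} r → a < q → (a + r * q) % q ≡ a
  [a+r*q]%q≡a {a} r a<q = trans ([m+kn]%n≡m%n a r q) (m<n⇒m%n≡m a<q)

  [a+r*q]/q≡r : ∀ {a} r → a < q → (a + r * q) / q ≡ r
  [a+r*q]/q≡r {a} r a<q = begin
    (a + r * q) / q    ≡⟨ +-distrib-/-∣ʳ a (divides-refl r) ⟩
    a / q + r * q / q  ≡⟨ cong₂ _+_ (m<n⇒m/n≡0 a<q) (m*n/n≡m r q) ⟩
    r                  ∎
    where open ≡-Reasoning

  toℕ-digit-zero : ∀ m → toℕ (digit q 0 m) ≡ m % q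
  toℕ-digit-zero m = trans (toℕ-fromℕ< _) (cong (_% q) (n/1≡n m))

  digit-suc : ∀ i m → digit q (suc i) m ≡ digit q i (m / q)
  digit-suc i m = toℕ-injective (begin
    toℕ (digit q (suc i) m)  ≡⟨ toℕ-fromℕ< _ ⟩
    (m / (q * q ^ i)) % q    ≡⟨ cong (_% q) (sym (m/n/o≡m/[n*o] m q (q ^ i))) ⟩
    (m / q / q ^ i) % q      ≡⟨ sym (toℕ-fromℕ< _) ⟩
    toℕ (digit q i (m / q))  ∎)
    where
    open ≡-Reasoning
    instance
      _ = m^n≢0 q i
      _ = m^n≢0 q (suc i)

  digit-withDigits : ∀ n (g : ℕ → Fin q) {i} → i < n → digit q i (withDigits n (toℕ ∘ g)) ≡ g i
  digit-withDigits (suc n) g {zero} _ = toℕ-injective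
    (trans (toℕ-digit-zero _) ([a+r*q]%q≡a (withDigits n (toℕ ∘ g ∘ suc)) (toℕ<n (g 0))))
  digit-withDigits (suc n) g {suc i} (s≤s i<n) = begin
    digit q (suc i) (withDigits (suc n) (toℕ ∘ g))  ≡⟨ digit-suc i _ ⟩
    digit q i (withDigits (suc n) (toℕ ∘ g) / q)    ≡⟨ cong (digit q i) ([a+r*q]/q≡r _ (toℕ<n (g 0))) ⟩
    digit q i (withDigits n (toℕ ∘ g ∘ suc))        ≡⟨ digit-withDigits n (g ∘ suc) i<n ⟩
    g (suc i)                                       ∎
    where open ≡-Reasoning

  n<withDigits : 2 ≤ q → ∀ n {g} → n < withDigits n g
  n<withDigits q≥2 zero    = s≤s z≤n
  n<withDigits q≥2 (suc n) {g} = begin-strict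
    suc n                 <⟨ m<m+n (suc n) (≤-<-trans z≤n ih) ⟩
    suc n + r             ≤⟨ +-monoˡ-≤ r ih ⟩
    r + r                 ≡⟨ cong (r +_) (sym (*-identityˡ r)) ⟩
    2 * r                 ≤⟨ *-monoˡ-≤ r q≥2 ⟩
    q * r                 ≡⟨ *-comm q r ⟩
    r * q                 ≤⟨ m≤n+m (r * q) (g 0) ⟩
    withDigits (suc n) g  ∎
    where
    open ≤-Reasoning
    r  = withDigits n (g ∘ suc)
    ih = n<withDigits q≥2 n {g ∘ suc}

record ExtensionGraph : Set₁ where
  infix 4 _~_
  field
    _~_      : ℕ → ℕ → Set
    _~?_     : ∀ x y → Dec (x ~ y)
    ~-sym    : ∀ {x y} → x ~ y → y ~ x
    ~-irrefl : ∀ {x} → ¬ x ~ x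
    extend   : ∀ L {P : ℕ → Set} → (∀ w → Dec (P w)) →
               ∃[ z ] z ∉ L × (∀ {w} → w ∈ L → z ~ w ⇔ P w)

DigitAdj : (q : ℕ) .{{_ : NonZero q}} → (Fin q → Set) → ℕ → ℕ → Set
DigitAdj q S x y = (x < y × S (digit q x y)) ⊎ (y < x × S (digit q y x))

module _ (q : ℕ) .{{_ : NonZero q}} (q≥2 : 2 ≤ q)
         {S : Fin q → Set} (S? : ∀ d → Dec (S d))
         {d₁ d₀ : Fin q} (d₁∈S : S d₁) (d₀∉S : ¬ S d₀) where
  open Digits q

  -- Since z exceeds every w ∈ L, whether z ~ w is decided by the w-th digit of z.
  DigitAdj-extend : ∀ L {P : ℕ → Set} → (∀ w → Dec (P w)) →
                    ∃[ z ] z ∉ L × (∀ {w} → w ∈ L → DigitAdj q S z w ⇔ P w)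
  DigitAdj-extend L {P} P? = z , (λ z∈L → <-irrefl refl (w<z z∈L)) , λ w∈L → mk⇔ (to w∈L) (from w∈L)
    where
    choose : ℕ → Fin q
    choose w with P? w
    ... | yes _ = d₁
    ... | no  _ = d₀

    S-choose : ∀ w → S (choose w) ⇔ P w
    S-choose w with P? w
    ... | yes p  = mk⇔ (λ _ → p) (λ _ → d₁∈S)
    ... | no  ¬p = mk⇔ (⊥-elim ∘ d₀∉S) (⊥-elim ∘ ¬p)

    n = suc (max 0 L)
    z = withDigits n (toℕ ∘ choose)

    w<n : ∀ {w} → w ∈ L → w < n
    w<n w∈L = s≤s (All.lookup (xs≤max 0 L) w∈L)

    w<z : ∀ {w} → w ∈ L → w < z
    w<z w∈L = <-trans (w<n w∈L) (n<withDigits q≥2 n {toℕ ∘ choose})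

    digit-z : ∀ {w} → w ∈ L → digit q w z ≡ choose w
    digit-z w∈L = digit-withDigits n choose (w<n w∈L)

    to : ∀ {w} → w ∈ L → DigitAdj q S z w → P w
    to w∈L (inj₁ (z<w , _)) = ⊥-elim (<-asym z<w (w<z w∈L))
    to {w} w∈L (inj₂ (_ , s)) = Equivalence.to (S-choose w) (subst S (digit-z w∈L) s)

    from : ∀ {w} → w ∈ L → P w → DigitAdj q S z w
    from {w} w∈L p = inj₂ (w<z w∈L , subst S (sym (digit-z w∈L)) (Equivalence.from (S-choose w) p))

  digitGraph : ExtensionGraph
  digitGraph = record
    { _~_      = DigitAdj q S
    ; _~?_     = λ x y → (x <? y ×-dec S? (digit q x y)) ⊎-dec (y <? x ×-dec S? (digit q y x))
    ; ~-sym    = [ inj₂ , inj₁ ]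
    ; ~-irrefl = [ <-irrefl refl ∘ proj₁ , <-irrefl refl ∘ proj₁ ]
    ; extend   = DigitAdj-extend
    }

module PartialIsomorphisms (G H : ExtensionGraph) where
  open ExtensionGraph G using () renaming (_~_ to _~ᴳ_; _~?_ to _~ᴳ?_; ~-sym to ~ᴳ-sym; ~-irrefl to ~ᴳ-irrefl)
  open ExtensionGraph H using () renaming (_~_ to _~ᴴ_; ~-sym to ~ᴴ-sym; ~-irrefl to ~ᴴ-irrefl; extend to extendᴴ)

  Compatible : ℕ × ℕ → ℕ × ℕ → Set
  Compatible (a , b) (a′ , b′) = (a ≡ a′ ⇔ b ≡ b′) × (a ~ᴳ a′ ⇔ b ~ᴴ b′)

  IsPartialIso : List (ℕ × ℕ) → Set
  IsPartialIso L = ∀ {p p′} → p ∈ L → p′ ∈ L → Compatible p p′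

  Compatible-refl : ∀ {p} → Compatible p p
  Compatible-refl = mk⇔ (λ _ → refl) (λ _ → refl) , mk⇔ (⊥-elim ∘ ~ᴳ-irrefl) (⊥-elim ∘ ~ᴴ-irrefl)

  Compatible-sym : ∀ {p p′} → Compatible p p′ → Compatible p′ p
  Compatible-sym (≡⇔≡ , ~⇔~) =
    mk⇔ (sym ∘ Equivalence.to ≡⇔≡ ∘ sym) (sym ∘ Equivalence.from ≡⇔≡ ∘ sym) ,
    mk⇔ (~ᴴ-sym ∘ Equivalence.to ~⇔~ ∘ ~ᴳ-sym) (~ᴳ-sym ∘ Equivalence.from ~⇔~ ∘ ~ᴴ-sym)

  forth : ∀ {L} → IsPartialIso L → ∀ a →
          ∃[ L′ ] IsPartialIso L′ × L ⊆ L′ × ∃[ b ] (a , b) ∈ L′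
  forth {L} iso a with any? (λ p → proj₁ p ≟ a) L
  ... | yes a∈dom with find a∈dom
  ...   | (a , b) , ab∈L , refl = L , iso , id , b , ab∈L
  forth {L} iso a | no a∉dom = (a , z) ∷ L , iso′ , there , z , here refl
    where
    -- b ~ᴴ z must hold exactly for the partners b of the G-neighbours of a
    Partner : ℕ → Set
    Partner w = Any (λ (a′ , b′) → b′ ≡ w × a ~ᴳ a′) L

    extension = extendᴴ (map proj₂ L) (λ w → any? (λ (a′ , b′) → (b′ ≟ w) ×-dec (a ~ᴳ? a′)) L)
    z = proj₁ extension

    new : ∀ {p′} → p′ ∈ L → Compatible (a , z) p′
    new {a′ , b′} ab′∈L =
      mk⇔ (λ { refl → ⊥-elim (a∉dom (lose ab′∈L refl)) })
          (λ { refl → ⊥-elim (proj₁ (proj₂ extension) (∈-map⁺ proj₂ ab′∈L)) }) ,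
      mk⇔ (λ a~a′ → Equivalence.from (z~b′⇔Partner) (lose ab′∈L (refl , a~a′)))
          (λ z~b′ → let _ , ab″∈L , b″≡b′ , a~a″ = find (Equivalence.to z~b′⇔Partner z~b′)
                    in subst (a ~ᴳ_) (Equivalence.from (proj₁ (iso ab″∈L ab′∈L)) b″≡b′) a~a″)
      where
      z~b′⇔Partner : z ~ᴴ b′ ⇔ Partner b′
      z~b′⇔Partner = proj₂ (proj₂ extension) (∈-map⁺ proj₂ ab′∈L)

    iso′ : IsPartialIso ((a , z) ∷ L)
    iso′ (here refl) (here refl) = Compatible-refl
    iso′ (here refl) (there p′∈L) = new p′∈L
    iso′ (there p∈L) (here refl) = Compatible-sym (new p∈L)
    iso′ (there p∈L) (there p′∈L) = iso p∈L p′∈L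

IsPartialIso-swap : ∀ G H {L} → PartialIsomorphisms.IsPartialIso G H L →
                    PartialIsomorphisms.IsPartialIso H G (map swap L)
IsPartialIso-swap G H iso p∈ p′∈ with ∈-map⁻ swap p∈ | ∈-map⁻ swap p′∈
... | _ , q∈L , refl | _ , q′∈L , refl = let ≡⇔≡ , ~⇔~ = iso q∈L q′∈L in ⇔-sym ≡⇔≡ , ⇔-sym ~⇔~

module BackAndForth (G H : ExtensionGraph) where
  open PartialIsomorphisms G H
  open ExtensionGraph G using () renaming (_~_ to _~ᴳ_)
  open ExtensionGraph H using () renaming (_~_ to _~ᴴ_)

  back : ∀ {L} → IsPartialIso L → ∀ b →
         ∃[ L′ ] IsPartialIso L′ × L ⊆ L′ × ∃[ a ] (a , b) ∈ L′
  back iso b with PartialIsomorphisms.forth H G (IsPartialIso-swap G H iso) b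
  ... | M , isoM , swapL⊆M , a , ba∈M =
    map swap M , IsPartialIso-swap H G isoM , ∈-map⁺ swap ∘ swapL⊆M ∘ ∈-map⁺ swap , a , ∈-map⁺ swap ba∈M

  record Step (L : List (ℕ × ℕ)) (k : ℕ) : Set where
    field
      next         : List (ℕ × ℕ)
      isPartialIso : IsPartialIso next
      ⊆-next       : L ⊆ next
      image        : ∃[ b ] (k , b) ∈ next
      preimage     : ∃[ a ] (a , k) ∈ next

  step : ∀ {L} → IsPartialIso L → ∀ k → Step L k
  step iso k with forth iso k
  ... | L₁ , iso₁ , L⊆L₁ , b , kb∈L₁ with back iso₁ k
  ... | L₂ , iso₂ , L₁⊆L₂ , a , ak∈L₂ = record
    { next = L₂ ; isPartialIso = iso₂ ; ⊆-next = L₁⊆L₂ ∘ L⊆L₁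
    ; image = b , L₁⊆L₂ kb∈L₁ ; preimage = a , ak∈L₂ }

  chain : ℕ → ∃[ L ] IsPartialIso L
  chain zero    = [] , λ ()
  chain (suc k) = Step.next s , Step.isPartialIso s
    where s = step (proj₂ (chain k)) k

  stepAt : ∀ k → Step (proj₁ (chain k)) k
  stepAt k = step (proj₂ (chain k)) k

  chain-mono : ∀ {k m} → k ≤′ m → proj₁ (chain k) ⊆ proj₁ (chain m)
  chain-mono (≤′-reflexive refl) = id
  chain-mono (≤′-step {m} k≤′m)  = Step.⊆-next (stepAt m) ∘ chain-mono k≤′m

  chain-compatible : ∀ i j {p p′} → p ∈ proj₁ (chain i) → p′ ∈ proj₁ (chain j) → Compatible p p′
  chain-compatible i j p∈ p′∈ = proj₂ (chain (i ⊔ j))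
    (chain-mono (≤⇒≤′ (m≤m⊔n i j)) p∈) (chain-mono (≤⇒≤′ (m≤n⊔m i j)) p′∈)

  f : ℕ → ℕ
  f x = proj₁ (Step.image (stepAt x))

  f-compatible : ∀ x y → Compatible (x , f x) (y , f y)
  f-compatible x y =
    chain-compatible (suc x) (suc y) (proj₂ (Step.image (stepAt x))) (proj₂ (Step.image (stepAt y)))

  isomorphism : GraphIso _~ᴳ_ _~ᴴ_
  isomorphism = mk⤖ (injective , surjective) , λ x y → proj₂ (f-compatible x y)
    where
    injective : ∀ {x y} → f x ≡ f y → x ≡ y
    injective {x} {y} = Equivalence.from (proj₁ (f-compatible x y))

    surjective : ∀ y → ∃[ x ] (∀ {z} → z ≡ x → f z ≡ y)
    surjective y = x , λ { refl → Equivalence.to (proj₁ compatible-x) refl }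
      where
      x = proj₁ (Step.preimage (stepAt y))
      compatible-x =
        chain-compatible (suc x) (suc y) (proj₂ (Step.image (stepAt x))) (proj₂ (Step.preimage (stepAt y)))

0<∣p∣⇒∃∈ : ∀ {n} (p : Subset n) → 1 ≤ ∣ p ∣ → ∃[ x ] x ∈ₛ p
0<∣p∣⇒∃∈ (inside  ∷ p) _     = zero , here
0<∣p∣⇒∃∈ (outside ∷ p) 0<∣p∣ = let x , x∈p = 0<∣p∣⇒∃∈ p 0<∣p∣ in suc x , there x∈p

∣p∣<n⇒∃∉ : ∀ {n} (p : Subset n) → ∣ p ∣ < n → ∃[ x ] x ∉ₛ p
∣p∣<n⇒∃∉ (outside ∷ p) _ = zero , λ ()
∣p∣<n⇒∃∉ (inside  ∷ p) (s≤s ∣p∣<n) =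
  let x , x∉p = ∣p∣<n⇒∃∉ p ∣p∣<n in suc x , λ { (there x∈p) → x∉p x∈p }

proposition2p3 : (q : ℕ) .{{_ : NonZero q}} → q ≥ 2 → (I : Subset q) →
    1 ≤ ∣ I ∣ → ∣ I ∣ < q → GraphIso (Adj q I) RadoAdj
proposition2p3 q q≥2 I 0<∣I∣ ∣I∣<q = BackAndForth.isomorphism
  (digitGraph q q≥2 (_∈? I) (proj₂ (0<∣p∣⇒∃∈ I 0<∣I∣)) (proj₂ (∣p∣<n⇒∃∉ I ∣I∣<q)))
  (digitGraph 2 ≤-refl (_≟ᶠ suc zero) {d₀ = zero} refl λ ())
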